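{- Let $L$ be a $T$-free or a $T$-full logic over $\mathcal{L}_\Box$. If at least one of Visser's rules is not admissible in $L$, then $L$ does not have a constructive sequent calculus.
   Context: $\mathcal{L}_\Box$: formulas built from atoms, $\top,\bot$ by $\wedge,\vee,\to,\Box$; $\neg A:=A\to\bot$. A logic over $\mathcal{L}_\Box$ is a set of $\mathcal{L}_\Box$-formulas closed under substitution, modus ponens and necessitation. $\mathsf{CK}_\Box$ is the smallest such logic containing intuitionistic propositional logic and $\Box(p\to q)\to(\Box p\to\Box q)$. One-node frames: truth at the node under a valuation is classical for $\top,\bot,\wedge,\vee,\to$; in the reflexive node frame $\mathcal{K}_r$, $\Box\varphi$ is true iff $\varphi$ is; in the irreflexive node frame $\mathcal{K}_i$, $\Box\varphi$ is always true; a logic is valid in a frame if each member is true under all valuations. $L$ is $T$-free if $\mathsf{CK}_\Box\subseteq L$ and $L$ is valid in $\mathcal{K}_i$; $T$-full if $\mathsf{CK}_\Box\subseteq L$, $\Box p\to p\in L$ and $L$ is valid in $\mathcal{K}_r$. Visser's rules: $V_0$ is the disjunction property ($A\vee B\in L$ implies $A\in L$ or $B\in L$); for $n\ge1$, $V_n$ infers $\bigvee_{j=1}^{n+2}(\bigwedge_{i=1}^n(p_i\to q_i)\to p_j)\vee r$ from $(\bigwedge_{i=1}^n(p_i\to q_i)\to p_{n+1}\vee p_{n+2})\vee r$; admissible in $L$ if for every substitution instance, premise in $L$ implies conclusion in $L$. Sequents $\Sigma\Rightarrow\Lambda$ (finite multisets); rules are meta-sequents with schematic atoms and multiset variables $\Gamma,\Delta$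 (and $\Box\Gamma$); a calculus is a finite set of rules; $G$ is a calculus for $L$ if $G\vdash\Sigma\Rightarrow\Lambda$ iff $\bigwedge\Sigma\to\bigvee\Lambda\in L$. Basic formulas (in the language with $\Diamond$ too): smallest set containing atoms, $\top,\bot$, closed under $\wedge,\vee,\Diamond$. Almost positive: smallest set containing basic formulas, closed under $\wedge,\vee,\Box,\Diamond$ and $A\to B$ ($A$ basic, $B$ almost positive). Constructive: smallest set containing basic formulas, closed under $\wedge,\Box$ and $A\to B$ ($A$ almost positive, $B$ constructive). A constructive rule is a single-conclusion rule either (left) with premises $\{\Gamma,\overline{B_i}\Rightarrow\overline{P_i}\}_{i\in I}\cup\{\Gamma,\overline{C_j}\Rightarrow\Delta\}_{j\in J}$ and conclusion $\Gamma,\overline{P}\Rightarrow\Delta$, or (right) with premises $\{\Gamma,\overline{B_i}\Rightarrow\overline{P_i}\}_{i\in I}$ and conclusion $\Gamma,\overline{P}\Rightarrow\overline{C}$; $\overline{B_i}$ multisets of basic formulas, $\overline{P},\overline{P_i}$ of almost positive formulas ($|\overline{P_i}|\le1$), $\overline{C_j}$ of constructive formulas, $\overline{C}$ at most one constructive formula, and if $|J|>1$ all formulas of $\bigcup_j\overline{C_j}$ are basic. A constructive sequent calculus over $\mathcal{L}_\Box$ is one (over $\mathcal{L}_\Box$) whose rules are constructive or are $(K_\Box)\ \frac{\Gamma\Rightarrow p}{\Box\Gamma\Rightarrow\Box p}$. -}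

module Defs where

open import Data.Nat using (ℕ; zero; suc; _<_)
open import Data.Bool using (Bool; true; false; _∧_; _∨_; not)
open import Data.Fin using (Fin; inject₁; fromℕ; raise; inject+)
open import Data.List using (List; []; _∷_; map; _++_; length; allFin)
open import Data.Maybe using (Maybe; just; nothing)
open import Data.Product using (Σ; _×_; _,_; proj₁; proj₂)
open import Data.Sum using (_⊎_)
open import Data.Empty using (⊥)
open import Relation.Nullary using (¬_)
open import Relation.Binary.PropositionalEquality using (_≡_)
open import Data.List.Relation.Unary.All using (All)
open import Data.List.Membership.Propositional using (_∈_)
open import Data.List.Relation.Binary.Permutation.Propositional using (_↭_)
import Data.Maybe.Relation.Unary.All as MaybeAll

-- The language L_□ (atoms indexed by ℕ); ¬A := A ⇒ ⊥

infixr 6 _∧ᶠ_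
infixr 5 _∨ᶠ_
infixr 4 _⇒_

data Fm : Set where
  var  : ℕ → Fm
  ⊤ᶠ ⊥ᶠ : Fm
  _∧ᶠ_ _∨ᶠ_ _⇒_ : Fm → Fm → Fm
  □_   : Fm → Fm

sub : (ℕ → Fm) → Fm → Fm
sub σ (var n)   = σ n
sub σ ⊤ᶠ        = ⊤ᶠ
sub σ ⊥ᶠ        = ⊥ᶠ
sub σ (A ∧ᶠ B)  = sub σ A ∧ᶠ sub σ B
sub σ (A ∨ᶠ B)  = sub σ A ∨ᶠ sub σ B
sub σ (A ⇒ B)   = sub σ A ⇒ sub σ B
sub σ (□ A)     = □ sub σ A

FmSet : Set₁
FmSet = Fm → Set

_⊆_ : FmSet → FmSet → Set
X ⊆ Y = ∀ A → X A → Y A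

record IsLogic (L : FmSet) : Set where
  field
    closed-sub : ∀ σ A → L A → L (sub σ A)
    closed-mp  : ∀ A B → L A → L (A ⇒ B) → L B
    closed-nec : ∀ A → L A → L (□ A)

data CK : FmSet where
  ax1  : ∀ A B → CK (A ⇒ (B ⇒ A))
  ax2  : ∀ A B C → CK ((A ⇒ (B ⇒ C)) ⇒ ((A ⇒ B) ⇒ (A ⇒ C)))
  ax3  : ∀ A B → CK ((A ∧ᶠ B) ⇒ A)
  ax4  : ∀ A B → CK ((A ∧ᶠ B) ⇒ B)
  ax5  : ∀ A B → CK (A ⇒ (B ⇒ (A ∧ᶠ B)))
  ax6  : ∀ A B → CK (A ⇒ (A ∨ᶠ B))
  ax7  : ∀ A B → CK (B ⇒ (A ∨ᶠ B))
  ax8  : ∀ A B C → CK ((A ⇒ C) ⇒ ((B ⇒ C) ⇒ ((A ∨ᶠ B) ⇒ C)))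
  ax9  : ∀ A → CK (⊥ᶠ ⇒ A)
  ax10 : CK ⊤ᶠ
  axK  : ∀ A B → CK (□ (A ⇒ B) ⇒ (□ A ⇒ □ B))
  mp   : ∀ {A B} → CK A → CK (A ⇒ B) → CK B
  nec  : ∀ {A} → CK A → CK (□ A)

-- One-node frames

data NodeKind : Set where
  reflexive irreflexive : NodeKind

_⇒ᵇ_ : Bool → Bool → Bool
a ⇒ᵇ b = not a ∨ b

eval : NodeKind → (ℕ → Bool) → Fm → Bool
eval k v (var n)  = v n
eval k v ⊤ᶠ       = true
eval k v ⊥ᶠ       = false
eval k v (A ∧ᶠ B) = eval k v A ∧ eval k v B
eval k v (A ∨ᶠ B) = eval k v A ∨ eval k v B
eval k v (A ⇒ B)  = eval k v A ⇒ᵇ eval k v B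
eval reflexive   v (□ A) = eval reflexive v A
eval irreflexive v (□ A) = true

ValidIn : NodeKind → FmSet → Set
ValidIn k L = ∀ A → L A → ∀ (v : ℕ → Bool) → eval k v A ≡ true

TFree : FmSet → Set
TFree L = CK ⊆ L × ValidIn irreflexive L

TFull : FmSet → Set
TFull L = CK ⊆ L × L (□ var 0 ⇒ var 0) × ValidIn reflexive L

-- conjunction / disjunction of a list (exact for nonempty lists)
⋀ : List Fm → Fm
⋀ []           = ⊤ᶠ
⋀ (A ∷ [])     = A
⋀ (A ∷ B ∷ Γ)  = A ∧ᶠ ⋀ (B ∷ Γ)

⋁ : List Fm → Fm
⋁ []           = ⊥ᶠ
⋁ (A ∷ [])     = A
⋁ (A ∷ B ∷ Γ)  = A ∨ᶠ ⋁ (B ∷ Γ)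

-- V_n for n = suc m ≥ 1; p : Fin (n+2) → Fm (p_1..p_{n+2}), q : Fin n → Fm
module _ (m : ℕ) (p : Fin (suc (suc (suc m))) → Fm) (q : Fin (suc m) → Fm) (r : Fm) where
  private
    n = suc m
    hyp : Fm
    hyp = ⋀ (map (λ i → p (inject₁ (inject₁ i)) ⇒ q i) (allFin n))
  visserPremise : Fm
  visserPremise =
    (hyp ⇒ (p (inject₁ (fromℕ n)) ∨ᶠ p (fromℕ (suc n)))) ∨ᶠ r
  visserConclusion : Fm
  visserConclusion =
    ⋁ (map (λ j → hyp ⇒ p j) (allFin (suc (suc n)))) ∨ᶠ r

-- admissibility of V_n in L (substitution instances: arbitrary formulas)
VisserAdmissible : FmSet → ℕ → Set
VisserAdmissible L zero = ∀ A B → L (A ∨ᶠ B) → L A ⊎ L B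
VisserAdmissible L (suc m) =
  ∀ p q r → L (visserPremise m p q r) → L (visserConclusion m p q r)

-- a sequent Σ ⇒ Λ with Σ a multiset (list up to permutation) and |Λ| ≤ 1
Seq : Set
Seq = List Fm × Maybe Fm

data MFm : Set where
  sat  : ℕ → MFm
  ⊤ᵐ ⊥ᵐ : MFm
  _∧ᵐ_ _∨ᵐ_ _⇒ᵐ_ : MFm → MFm → MFm
  □ᵐ_  : MFm → MFm

inst : (ℕ → Fm) → MFm → Fm
inst σ (sat n)   = σ n
inst σ ⊤ᵐ        = ⊤ᶠ
inst σ ⊥ᵐ        = ⊥ᶠ
inst σ (A ∧ᵐ B)  = inst σ A ∧ᶠ inst σ B
inst σ (A ∨ᵐ B)  = inst σ A ∨ᶠ inst σ B
inst σ (A ⇒ᵐ B)  = inst σ A ⇒ inst σ B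
inst σ (□ᵐ A)    = □ inst σ A

data CtxVar : Set where
  noCtx ctxΓ ctx□Γ : CtxVar

data Succ : Set where
  succΔ : Succ
  succF : Maybe MFm → Succ

record MSeq : Set where
  constructor mseq
  field
    ctx  : CtxVar
    ante : List MFm
    succ : Succ

record Rule : Set where
  constructor rule
  field
    premises   : List MSeq
    conclusion : MSeq

instCtx : List Fm → CtxVar → List Fm
instCtx γ noCtx = []
instCtx γ ctxΓ  = γ
instCtx γ ctx□Γ = map □_ γ

instSeq : (ℕ → Fm) → List Fm → Maybe Fm → MSeq → Seq
instSeq σ γ δ (mseq c a succΔ) = instCtx γ c ++ map (inst σ) a , δ
instSeq σ γ δ (mseq c a (succF s)) =
  instCtx γ c ++ map (inst σ) a , Data.Maybe.map (inst σ) s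

_≈ˢ_ : Seq → Seq → Set
(Σ₁ , Λ₁) ≈ˢ (Σ₂ , Λ₂) = (Σ₁ ↭ Σ₂) × (Λ₁ ≡ Λ₂)

Calculus : Set
Calculus = List Rule

data _⊢_ (G : Calculus) : Seq → Set where
  by : ∀ {S} (r : Rule) → r ∈ G →
       (σ : ℕ → Fm) (γ : List Fm) (δ : Maybe Fm) →
       instSeq σ γ δ (Rule.conclusion r) ≈ˢ S →
       All (λ P → G ⊢ instSeq σ γ δ P) (Rule.premises r) →
       G ⊢ S

⋁? : Maybe Fm → Fm
⋁? nothing  = ⊥ᶠ
⋁? (just A) = A

CalculusFor : Calculus → FmSet → Set
CalculusFor G L = ∀ (Σ₀ : List Fm) (Λ : Maybe Fm) →
  ((G ⊢ (Σ₀ , Λ)) → L (⋀ Σ₀ ⇒ ⋁? Λ)) × (L (⋀ Σ₀ ⇒ ⋁? Λ) → G ⊢ (Σ₀ , Λ))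

data IsBasic : MFm → Set where
  b-at  : ∀ n → IsBasic (sat n)
  b-⊤   : IsBasic ⊤ᵐ
  b-⊥   : IsBasic ⊥ᵐ
  b-∧   : ∀ {A B} → IsBasic A → IsBasic B → IsBasic (A ∧ᵐ B)
  b-∨   : ∀ {A B} → IsBasic A → IsBasic B → IsBasic (A ∨ᵐ B)

data IsAlmostPositive : MFm → Set where
  ap-basic : ∀ {A} → IsBasic A → IsAlmostPositive A
  ap-∧ : ∀ {A B} → IsAlmostPositive A → IsAlmostPositive B → IsAlmostPositive (A ∧ᵐ B)
  ap-∨ : ∀ {A B} → IsAlmostPositive A → IsAlmostPositive B → IsAlmostPositive (A ∨ᵐ B)
  ap-□ : ∀ {A} → IsAlmostPositive A → IsAlmostPositive (□ᵐ A)
  ap-⇒ : ∀ {A B} → IsBasic A → IsAlmostPositive B → IsAlmostPositive (A ⇒ᵐ B)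

data IsConstructiveFm : MFm → Set where
  c-basic : ∀ {A} → IsBasic A → IsConstructiveFm A
  c-∧ : ∀ {A B} → IsConstructiveFm A → IsConstructiveFm B → IsConstructiveFm (A ∧ᵐ B)
  c-□ : ∀ {A} → IsConstructiveFm A → IsConstructiveFm (□ᵐ A)
  c-⇒ : ∀ {A B} → IsAlmostPositive A → IsConstructiveFm B → IsConstructiveFm (A ⇒ᵐ B)

IPrem : Set
IPrem = List MFm × Maybe MFm

GoodIPrem : IPrem → Set
GoodIPrem (B , P) = All IsBasic B × MaybeAll.All IsAlmostPositive P

iPrem : IPrem → MSeq
iPrem (B , P) = mseq ctxΓ B (succF P)

jPrem : List MFm → MSeq
jPrem C = mseq ctxΓ C succΔ

data IsConstructiveRule : Rule → Set where
  left  : (Is : List IPrem) (Js : List (List MFm)) (P : List MFm) (prs : List MSeq) →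
          All GoodIPrem Is →
          All (All IsConstructiveFm) Js →
          (1 < length Js → All (All IsBasic) Js) →
          All IsAlmostPositive P →
          prs ↭ (map iPrem Is ++ map jPrem Js) →
          IsConstructiveRule (rule prs (mseq ctxΓ P succΔ))
  right : (Is : List IPrem) (P : List MFm) (C : Maybe MFm) (prs : List MSeq) →
          All GoodIPrem Is →
          All IsAlmostPositive P →
          MaybeAll.All IsConstructiveFm C →
          prs ↭ map iPrem Is →
          IsConstructiveRule (rule prs (mseq ctxΓ P (succF C)))

-- (K_□):  Γ ⇒ p  /  □Γ ⇒ □p
K□-rule : Rule
K□-rule = rule (mseq ctxΓ [] (succF (just (sat 0))) ∷ [])
               (mseq ctx□Γ [] (succF (just (□ᵐ sat 0))))

ConstructiveCalculus : Calculus → Set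
ConstructiveCalculus G = All (λ r → IsConstructiveRule r ⊎ r ≡ K□-rule) G

module Submission where

-- A constructive calculus is sound for a version of Aczel's slash relative to L, in which the
-- implications are read in a continuation monad with answer type S.  In a rule case one
-- instantiates Γ by the conjunction π of the rule's premises (with Γ erased): every premise is
-- then derivable, so π together with the conclusion's antecedent implies its succedent in L,
-- hence in the one-node frame.  A valuation agreeing with the slash on the finitely many atoms
-- involved, chosen by excluded middle inside the monad, turns this into the truth values that
-- the slash needs: basic and almost positive formulas are evaluated, constructive ones slashed.
-- Slashing a derivable [] ⇒ A ∨ B gives the disjunction property; for Visser's rules the
-- slash of each p_i ⇒ q_i in the hypothesis aborts with the answer p_i.

open import Data.Bool using (Bool; true; false; _∧_; _∨_)
open import Data.Empty using (⊥; ⊥-elim)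
open import Data.Fin using (Fin; inject₁; fromℕ)
open import Data.List using (List; []; _∷_; map; _++_; length; concatMap; allFin)
open import Data.List.Membership.Propositional using (_∈_; find)
open import Data.List.Membership.Propositional.Properties using (∈-map⁺; ∈-++⁺ˡ; ∈-++⁺ʳ; ∈-allFin)
open import Data.List.Properties using (++-identityʳ)
open import Data.List.Relation.Binary.Permutation.Propositional using (_↭_; ↭-sym; ↭-refl)
open import Data.List.Relation.Binary.Permutation.Propositional.Properties using (All-resp-↭)
open import Data.List.Relation.Unary.All using (All; []; _∷_)
import Data.List.Relation.Unary.All as All
open import Data.List.Relation.Unary.All.Properties using (++⁺; ++⁻ˡ; ++⁻ʳ; map⁺; map⁻; tabulate⁺)
open import Data.List.Relation.Unary.Any using (Any; here; there)
import Data.List.Relation.Unary.Any as Any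
import Data.List.Relation.Unary.Any.Properties as Any
open import Data.Maybe using (Maybe; just; nothing)
import Data.Maybe as Maybe
import Data.Maybe.Relation.Unary.All as MaybeAll
open import Data.Nat using (ℕ; zero; suc; _<_; _<?_; _≟_; s≤s; z≤n)
open import Data.Product using (Σ; _×_; _,_; proj₁; proj₂)
open import Data.Sum using (_⊎_; inj₁; inj₂; [_,_]′)
open import Data.Unit using (tt) renaming (⊤ to Unit)
open import Effect.Monad using (RawMonad; mkRawMonad)
open import Function using (_∘_)
open import Relation.Nullary using (¬_; yes; no)
open import Relation.Binary.PropositionalEquality using (_≡_; refl; subst)

open import Defs

module Hilbert {L : FmSet} (isL : IsLogic L) (ck : CK ⊆ L) where
  open IsLogic isL

  infix 3 _⇛_
  _⇛_ : Fm → Fm → Set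
  A ⇛ B = L (A ⇒ B)

  axiom : ∀ {A} → CK A → L A
  axiom = ck _

  modus-ponens : ∀ {A B} → L A → A ⇛ B → L B
  modus-ponens = closed-mp _ _

  ⇛-const : ∀ {A B} → L B → A ⇛ B
  ⇛-const {A} {B} b = modus-ponens b (axiom (ax1 B A))

  ⇛-app : ∀ {A B C} → A ⇛ B → A ⇛ (B ⇒ C) → A ⇛ C
  ⇛-app {A} {B} {C} ab abc = modus-ponens ab (modus-ponens abc (axiom (ax2 A B C)))

  ⇛-refl : ∀ {A} → A ⇛ A
  ⇛-refl {A} = ⇛-app (axiom (ax1 A A)) (axiom (ax1 A (A ⇒ A)))

  ⇛-trans : ∀ {A B C} → A ⇛ B → B ⇛ C → A ⇛ C
  ⇛-trans ab bc = ⇛-app ab (⇛-const bc)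

  ∧-intro : ∀ {A B C} → A ⇛ B → A ⇛ C → A ⇛ (B ∧ᶠ C)
  ∧-intro {B = B} {C} ab ac = ⇛-app ac (⇛-app ab (⇛-const (axiom (ax5 B C))))

  ∧-elimˡ : ∀ {A B C} → A ⇛ (B ∧ᶠ C) → A ⇛ B
  ∧-elimˡ {B = B} {C} h = ⇛-trans h (axiom (ax3 B C))

  ∧-elimʳ : ∀ {A B C} → A ⇛ (B ∧ᶠ C) → A ⇛ C
  ∧-elimʳ {B = B} {C} h = ⇛-trans h (axiom (ax4 B C))

  ∨-introˡ : ∀ {A B C} → A ⇛ B → A ⇛ (B ∨ᶠ C)
  ∨-introˡ {B = B} {C} h = ⇛-trans h (axiom (ax6 B C))

  ∨-introʳ : ∀ {A B C} → A ⇛ C → A ⇛ (B ∨ᶠ C)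
  ∨-introʳ {B = B} {C} h = ⇛-trans h (axiom (ax7 B C))

  ⊤-intro : ∀ {A} → A ⇛ ⊤ᶠ
  ⊤-intro = ⇛-const (axiom ax10)

  □-mono : ∀ {A B} → A ⇛ B → □ A ⇛ □ B
  □-mono {A} {B} h = modus-ponens (closed-nec _ h) (axiom (axK A B))

  □-∧-intro : ∀ {X A B} → X ⇛ □ A → X ⇛ □ B → X ⇛ □ (A ∧ᶠ B)
  □-∧-intro {A = A} {B} xa xb =
    ⇛-app xb (⇛-trans xa (⇛-trans (□-mono (axiom (ax5 A B))) (axiom (axK B (A ∧ᶠ B)))))

  ⋀-proj : ∀ {xs y} → y ∈ xs → ⋀ xs ⇛ y
  ⋀-proj {_ ∷ []}    (here refl) = ⇛-refl
  ⋀-proj {_ ∷ _ ∷ _} (here refl) = ∧-elimˡ ⇛-refl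
  ⋀-proj {_ ∷ _ ∷ _} (there y∈) = ⇛-trans (∧-elimʳ ⇛-refl) (⋀-proj y∈)

  ⋀-intro : ∀ {A xs} → All (A ⇛_) xs → A ⇛ ⋀ xs
  ⋀-intro []           = ⊤-intro
  ⋀-intro (h ∷ [])     = h
  ⋀-intro (h ∷ h′ ∷ hs) = ∧-intro h (⋀-intro (h′ ∷ hs))

  ⋀-mono : ∀ {xs ys} → (∀ {y} → y ∈ ys → y ∈ xs) → ⋀ xs ⇛ ⋀ ys
  ⋀-mono ys⊆xs = ⋀-intro (All.tabulate (λ y∈ → ⋀-proj (ys⊆xs y∈)))

  ⇛-uncurry : ∀ {π xs C} → π ⇛ (⋀ xs ⇒ C) → ⋀ (π ∷ xs) ⇛ C
  ⇛-uncurry {π} {xs} h =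
    ⇛-app (⋀-mono {π ∷ xs} {xs} there) (⇛-trans (⋀-proj {π ∷ xs} (here refl)) h)

  □-⋀-intro : ∀ {A xs} → All (λ x → A ⇛ □ x) xs → A ⇛ □ ⋀ xs
  □-⋀-intro []           = ⇛-const (closed-nec _ (axiom ax10))
  □-⋀-intro (h ∷ [])     = h
  □-⋀-intro (h ∷ h′ ∷ hs) = □-∧-intro h (□-⋀-intro (h′ ∷ hs))

  ⋁-inj : ∀ {xs y} → y ∈ xs → y ⇛ ⋁ xs
  ⋁-inj {_ ∷ []}    (here refl) = ⇛-refl
  ⋁-inj {_ ∷ _ ∷ _} (here refl) = ∨-introˡ ⇛-refl
  ⋁-inj {_ ∷ _ ∷ _} (there y∈) = ⇛-trans (⋁-inj y∈) (∨-introʳ ⇛-refl)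

∧≡true⁺ : ∀ {a b} → a ≡ true → b ≡ true → a ∧ b ≡ true
∧≡true⁺ refl refl = refl

∧≡true⁻ : ∀ {a b} → a ∧ b ≡ true → a ≡ true × b ≡ true
∧≡true⁻ {true} b≡true = refl , b≡true

∧≡false⁻ : ∀ {a b} → a ∧ b ≡ false → a ≡ false ⊎ b ≡ false
∧≡false⁻ {false} _       = inj₁ refl
∧≡false⁻ {true}  b≡false = inj₂ b≡false

∨≡true⁺ˡ : ∀ {a b} → a ≡ true → a ∨ b ≡ true
∨≡true⁺ˡ refl = refl

∨≡true⁺ʳ : ∀ {a b} → b ≡ true → a ∨ b ≡ true
∨≡true⁺ʳ {true}  _      = refl
∨≡true⁺ʳ {false} b≡true = b≡true

∨≡true⁻ : ∀ {a b} → a ∨ b ≡ true → a ≡ true ⊎ b ≡ true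
∨≡true⁻ {true}  _      = inj₁ refl
∨≡true⁻ {false} b≡true = inj₂ b≡true

⇒ᵇ≡true⁻ : ∀ {a b} → (a ⇒ᵇ b) ≡ true → a ≡ true → b ≡ true
⇒ᵇ≡true⁻ b≡true refl = b≡true

⇒ᵇfalse≡false⁻ : ∀ {a} → (a ⇒ᵇ false) ≡ false → a ≡ true
⇒ᵇfalse≡false⁻ {true} _ = refl

module Evaluation (k : NodeKind) (v : ℕ → Bool) where

  ⋀-true⁺ : ∀ {xs} → All (λ x → eval k v x ≡ true) xs → eval k v (⋀ xs) ≡ true
  ⋀-true⁺ []           = refl
  ⋀-true⁺ (t ∷ [])     = t
  ⋀-true⁺ (t ∷ t′ ∷ ts) = ∧≡true⁺ t (⋀-true⁺ (t′ ∷ ts))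

  ⋀-true⁻ : ∀ xs → eval k v (⋀ xs) ≡ true → All (λ x → eval k v x ≡ true) xs
  ⋀-true⁻ []           _ = []
  ⋀-true⁻ (x ∷ [])     t = t ∷ []
  ⋀-true⁻ (x ∷ y ∷ xs) t = let tx , txs = ∧≡true⁻ {eval k v x} t in tx ∷ ⋀-true⁻ (y ∷ xs) txs

  ⋀-false⁻ : ∀ xs → eval k v (⋀ xs) ≡ false → Any (λ x → eval k v x ≡ false) xs
  ⋀-false⁻ (x ∷ [])     f = here f
  ⋀-false⁻ (x ∷ y ∷ xs) f = [ here , there ∘ ⋀-false⁻ (y ∷ xs) ]′ (∧≡false⁻ {eval k v x} f)

atoms : MFm → List ℕ
atoms (sat n)  = n ∷ []
atoms ⊤ᵐ       = []
atoms ⊥ᵐ       = []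
atoms (A ∧ᵐ B) = atoms A ++ atoms B
atoms (A ∨ᵐ B) = atoms A ++ atoms B
atoms (A ⇒ᵐ B) = atoms A ++ atoms B
atoms (□ᵐ A)   = atoms A

atomsᴸ : List MFm → List ℕ
atomsᴸ = concatMap atoms

atomsᴹ : Maybe MFm → List ℕ
atomsᴹ = Maybe.maybe′ atoms []

iPremAtoms : IPrem → List ℕ
iPremAtoms (B , P) = atomsᴸ B ++ atomsᴹ P

∈-length≤1⇒≡ : ∀ {A : Set} {xs : List A} {x y} → ¬ 1 < length xs → x ∈ xs → y ∈ xs → y ≡ x
∈-length≤1⇒≡ {xs = _ ∷ []}    _    (here refl) (here refl) = refl
∈-length≤1⇒≡ {xs = _ ∷ _ ∷ _} len≤1 _          _           = ⊥-elim (len≤1 (s≤s (s≤s z≤n)))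

data FrameAxiom (L : FmSet) : NodeKind → Set where
  irreflexive-frame : FrameAxiom L irreflexive
  reflexive-frame   : (∀ A → L (□ A ⇒ A)) → FrameAxiom L reflexive

IfReflexive : NodeKind → Set → Set
IfReflexive reflexive   X = X
IfReflexive irreflexive X = Unit

module Slash {L : FmSet} (isL : IsLogic L) (ck : CK ⊆ L) {k : NodeKind}
             (frame : FrameAxiom L k) (H : Fm) (S : Set) where
  open Hilbert isL ck

  Prov : Fm → Set
  Prov A = H ⇛ A

  Cont : Set → Set
  Cont X = (X → S) → S

  cont-monad : RawMonad Cont
  cont-monad = mkRawMonad Cont (λ x κ → κ x) (λ m f κ → m (λ x → f x κ))

  open RawMonad cont-monad public using (pure; _>>=_; _<$>_)

  Slash : Fm → Set
  Slash (var n)  = Prov (var n)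
  Slash ⊤ᶠ       = Unit
  Slash ⊥ᶠ       = ⊥
  Slash (A ∧ᶠ B) = Slash A × Slash B
  Slash (A ∨ᶠ B) = Slash A ⊎ Slash B
  Slash (A ⇒ B)  = Prov (A ⇒ B) × (Slash A → Cont (Slash B))
  Slash (□ A)    = Prov (□ A) × IfReflexive k (Slash A)

  slash-prov : ∀ A → Slash A → Prov A
  slash-prov (var n)  p        = p
  slash-prov ⊤ᶠ       _        = ⊤-intro
  slash-prov ⊥ᶠ       ()
  slash-prov (A ∧ᶠ B) (a , b)  = ∧-intro (slash-prov A a) (slash-prov B b)
  slash-prov (A ∨ᶠ B) (inj₁ a) = ∨-introˡ (slash-prov A a)
  slash-prov (A ∨ᶠ B) (inj₂ b) = ∨-introʳ (slash-prov B b)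
  slash-prov (A ⇒ B)  (p , _)  = p
  slash-prov (□ A)    (p , _)  = p

  slash-⋀ : ∀ {xs} → All Slash xs → Slash (⋀ xs)
  slash-⋀ []           = tt
  slash-⋀ (s ∷ [])     = s
  slash-⋀ (s ∷ s′ ∷ ss) = s , slash-⋀ (s′ ∷ ss)

  Agrees : Bool → Fm → Set
  Agrees true  A = Slash A
  Agrees false A = Slash A → S

  AgreesOn : (ℕ → Fm) → (ℕ → Bool) → List ℕ → Set
  AgreesOn σ v ns = ∀ {n} → n ∈ ns → Agrees (v n) (σ n)

  update : (ℕ → Bool) → ℕ → Bool → ℕ → Bool
  update v n b m with m ≟ n
  ... | yes _ = b
  ... | no  _ = v m

  agreesOn-update : ∀ {σ v ns n b} → AgreesOn σ v ns → Agrees b (σ n) →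
                    AgreesOn σ (update v n b) (n ∷ ns)
  agreesOn-update {n = n} agree agree-n {m} m∈ with m ≟ n | m∈
  ... | yes refl | _          = agree-n
  ... | no  m≢n  | here m≡n   = ⊥-elim (m≢n m≡n)
  ... | no  _    | there m∈ns = agree m∈ns

  -- Excluded middle in continuation-passing style: n is first declared false, and should the
  -- continuation ever apply that refutation to a slash of σ n, it is restarted with n true.
  choose-valuation : ∀ σ ns → Cont (Σ (ℕ → Bool) λ v → AgreesOn σ v ns)
  choose-valuation σ []       = pure ((λ _ → false) , λ ())
  choose-valuation σ (n ∷ ns) κ = choose-valuation σ ns λ { (v , agree) →
    κ (update v n false , agreesOn-update agree λ s →
      κ (update v n true , agreesOn-update agree s)) }

  module UnderValuation (σ : ℕ → Fm) (v : ℕ → Bool) where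

    ⟦_⟧ : MFm → Bool
    ⟦ a ⟧ = eval k v (inst var a)

    agreesOn-++ˡ : ∀ {xs ys} → AgreesOn σ v (xs ++ ys) → AgreesOn σ v xs
    agreesOn-++ˡ agree n∈ = agree (∈-++⁺ˡ n∈)

    agreesOn-++ʳ : ∀ xs {ys} → AgreesOn σ v (xs ++ ys) → AgreesOn σ v ys
    agreesOn-++ʳ xs agree n∈ = agree (∈-++⁺ʳ xs n∈)

    agreesOn-concatMap : ∀ {A : Set} (f : A → List ℕ) {xs x} → x ∈ xs →
                         AgreesOn σ v (concatMap f xs) → AgreesOn σ v (f x)
    agreesOn-concatMap f (here refl) agree = agreesOn-++ˡ agree
    agreesOn-concatMap f {x′ ∷ _} (there x∈) agree =
      agreesOn-concatMap f x∈ (agreesOn-++ʳ (f x′) agree)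

    basic-slash : ∀ {a} → IsBasic a → AgreesOn σ v (atoms a) → ⟦ a ⟧ ≡ true → Slash (inst σ a)
    basic-slash (b-at n) agree t = subst (λ b → Agrees b (σ n)) t (agree (here refl))
    basic-slash b-⊤ _ _ = tt
    basic-slash b-⊥ _ ()
    basic-slash {A ∧ᵐ B} (b-∧ bA bB) agree t with ∧≡true⁻ {⟦ A ⟧} t
    ... | tA , tB =
      basic-slash bA (agreesOn-++ˡ agree) tA , basic-slash bB (agreesOn-++ʳ (atoms A) agree) tB
    basic-slash {A ∨ᵐ B} (b-∨ bA bB) agree t with ∨≡true⁻ {⟦ A ⟧} t
    ... | inj₁ tA = inj₁ (basic-slash bA (agreesOn-++ˡ agree) tA)
    ... | inj₂ tB = inj₂ (basic-slash bB (agreesOn-++ʳ (atoms A) agree) tB)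

    basic-true : ∀ {a} → IsBasic a → AgreesOn σ v (atoms a) → Slash (inst σ a) → Cont (⟦ a ⟧ ≡ true)
    basic-true (b-at n) agree s with v n | agree (here refl)
    ... | true  | _      = pure refl
    ... | false | refute = λ _ → refute s
    basic-true b-⊤ _ _ = pure refl
    basic-true b-⊥ _ ()
    basic-true {A ∧ᵐ B} (b-∧ bA bB) agree (sA , sB) = do
      tA ← basic-true bA (agreesOn-++ˡ agree) sA
      tB ← basic-true bB (agreesOn-++ʳ (atoms A) agree) sB
      pure (∧≡true⁺ tA tB)
    basic-true {A ∨ᵐ B} (b-∨ bA bB) agree (inj₁ sA) =
      ∨≡true⁺ˡ <$> basic-true bA (agreesOn-++ˡ agree) sA
    basic-true {A ∨ᵐ B} (b-∨ bA bB) agree (inj₂ sB) =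
      ∨≡true⁺ʳ {⟦ A ⟧} <$> basic-true bB (agreesOn-++ʳ (atoms A) agree) sB

    almostPositive-true : ∀ {a} → IsAlmostPositive a → AgreesOn σ v (atoms a) →
                          Slash (inst σ a) → Cont (⟦ a ⟧ ≡ true)
    almostPositive-true-□ : ∀ {a} → FrameAxiom L k → IsAlmostPositive a → AgreesOn σ v (atoms a) →
                            Slash (inst σ (□ᵐ a)) → Cont (⟦ □ᵐ a ⟧ ≡ true)

    almostPositive-true (ap-basic b) agree s = basic-true b agree s
    almostPositive-true {A ∧ᵐ B} (ap-∧ pA pB) agree (sA , sB) = do
      tA ← almostPositive-true pA (agreesOn-++ˡ agree) sA
      tB ← almostPositive-true pB (agreesOn-++ʳ (atoms A) agree) sB
      pure (∧≡true⁺ tA tB)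
    almostPositive-true {A ∨ᵐ B} (ap-∨ pA pB) agree (inj₁ sA) =
      ∨≡true⁺ˡ <$> almostPositive-true pA (agreesOn-++ˡ agree) sA
    almostPositive-true {A ∨ᵐ B} (ap-∨ pA pB) agree (inj₂ sB) =
      ∨≡true⁺ʳ {⟦ A ⟧} <$> almostPositive-true pB (agreesOn-++ʳ (atoms A) agree) sB
    almostPositive-true (ap-□ pA) agree s = almostPositive-true-□ frame pA agree s
    almostPositive-true {A ⇒ᵐ B} (ap-⇒ bA pB) agree (_ , f) with ⟦ A ⟧ in tA
    ... | false = pure refl
    ... | true  = do
      sB ← f (basic-slash bA (agreesOn-++ˡ agree) tA)
      almostPositive-true pB (agreesOn-++ʳ (atoms A) agree) sB

    almostPositive-true-□ irreflexive-frame   _  _     _       = pure refl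
    almostPositive-true-□ (reflexive-frame _) pA agree (_ , s) = almostPositive-true pA agree s

    constructive-slash : ∀ {c} → IsConstructiveFm c → AgreesOn σ v (atoms c) → ⟦ c ⟧ ≡ true →
                         Prov (inst σ c) → Cont (Slash (inst σ c))
    constructive-slash-□ : ∀ {c} → FrameAxiom L k → IsConstructiveFm c → AgreesOn σ v (atoms c) →
                           ⟦ □ᵐ c ⟧ ≡ true → Prov (inst σ (□ᵐ c)) → Cont (Slash (inst σ (□ᵐ c)))

    constructive-slash (c-basic b) agree t _ = pure (basic-slash b agree t)
    constructive-slash {A ∧ᵐ B} (c-∧ cA cB) agree t p with ∧≡true⁻ {⟦ A ⟧} t
    ... | tA , tB = do
      sA ← constructive-slash cA (agreesOn-++ˡ agree) tA (∧-elimˡ p)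
      sB ← constructive-slash cB (agreesOn-++ʳ (atoms A) agree) tB (∧-elimʳ p)
      pure (sA , sB)
    constructive-slash (c-□ cA) agree t p = constructive-slash-□ frame cA agree t p
    constructive-slash {A ⇒ᵐ B} (c-⇒ pA cB) agree t p = pure (p , λ sA → do
      tA ← almostPositive-true pA (agreesOn-++ˡ agree) sA
      constructive-slash cB (agreesOn-++ʳ (atoms A) agree) (⇒ᵇ≡true⁻ t tA)
        (⇛-app (slash-prov _ sA) p))

    constructive-slash-□ irreflexive-frame     _  _     _ p = pure (p , tt)
    constructive-slash-□ (reflexive-frame axT) cA agree t p =
      (p ,_) <$> constructive-slash cA agree t (⇛-trans p (axT _))

    basic-slash-all : ∀ {as} → All IsBasic as → AgreesOn σ v (atomsᴸ as) →
                      All (λ a → ⟦ a ⟧ ≡ true) as → All (λ a → Slash (inst σ a)) as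
    basic-slash-all []                _    []       = []
    basic-slash-all {a ∷ _} (b ∷ bs) agree (t ∷ ts) =
      basic-slash b (agreesOn-++ˡ agree) t ∷ basic-slash-all bs (agreesOn-++ʳ (atoms a) agree) ts

    almostPositive-true-all : ∀ {as} → All IsAlmostPositive as → AgreesOn σ v (atomsᴸ as) →
                              All (λ a → Slash (inst σ a)) as → Cont (All (λ a → ⟦ a ⟧ ≡ true) as)
    almostPositive-true-all []                _    []       = pure []
    almostPositive-true-all {a ∷ _} (p ∷ ps) agree (s ∷ ss) = do
      t  ← almostPositive-true p (agreesOn-++ˡ agree) s
      ts ← almostPositive-true-all ps (agreesOn-++ʳ (atoms a) agree) ss
      pure (t ∷ ts)

    constructive-slash-all : ∀ {cs} → All IsConstructiveFm cs → AgreesOn σ v (atomsᴸ cs) →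
                             All (λ c → ⟦ c ⟧ ≡ true) cs → All (λ c → Prov (inst σ c)) cs →
                             Cont (All (λ c → Slash (inst σ c)) cs)
    constructive-slash-all []                _    []       []       = pure []
    constructive-slash-all {c ∷ _} (x ∷ xs) agree (t ∷ ts) (p ∷ ps) = do
      s  ← constructive-slash x (agreesOn-++ˡ agree) t p
      ss ← constructive-slash-all xs (agreesOn-++ʳ (atoms c) agree) ts ps
      pure (s ∷ ss)

    almostPositive-trueᴹ : ∀ {P} → MaybeAll.All IsAlmostPositive P → AgreesOn σ v (atomsᴹ P) →
                           Slash (⋁? (Maybe.map (inst σ) P)) →
                           Cont (eval k v (⋁? (Maybe.map (inst var) P)) ≡ true)
    almostPositive-trueᴹ (MaybeAll.just p) agree s = almostPositive-true p agree s
    almostPositive-trueᴹ MaybeAll.nothing  _     ()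

    constructive-slashᴹ : ∀ {C} → MaybeAll.All IsConstructiveFm C → AgreesOn σ v (atomsᴹ C) →
                          eval k v (⋁? (Maybe.map (inst var) C)) ≡ true →
                          Prov (⋁? (Maybe.map (inst σ) C)) → Cont (Slash (⋁? (Maybe.map (inst σ) C)))
    constructive-slashᴹ (MaybeAll.just c) agree t p = constructive-slash c agree t p
    constructive-slashᴹ MaybeAll.nothing  _     ()

module Soundness {L : FmSet} (isL : IsLogic L) (ck : CK ⊆ L) {k : NodeKind}
                 (frame : FrameAxiom L k) (valid : ValidIn k L)
                 {G : Calculus} (constructive : ConstructiveCalculus G)
                 (calculus : CalculusFor G L) (H : Fm) (S : Set) where
  open Hilbert isL ck
  open Slash isL ck frame H S public
  open Evaluation k

  sound : ∀ {Σ₀ Λ} → G ⊢ (Σ₀ , Λ) → ⋀ Σ₀ ⇛ ⋁? Λ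
  sound = proj₁ (calculus _ _)

  complete : ∀ {Σ₀ Λ} → ⋀ Σ₀ ⇛ ⋁? Λ → G ⊢ (Σ₀ , Λ)
  complete = proj₂ (calculus _ _)

  complete-uncurried : ∀ {π xs Λ} → π ⇛ (⋀ xs ⇒ ⋁? Λ) → G ⊢ (π ∷ xs , Λ)
  complete-uncurried {π} {xs} h = complete (⇛-uncurry {π} {xs} h)

  derivable-prov : ∀ {Σ₀ Λ} → G ⊢ (Σ₀ , Λ) → All Slash Σ₀ → Prov (⋁? Λ)
  derivable-prov d s = ⇛-trans (slash-prov _ (slash-⋀ s)) (sound d)

  rule-instance : ∀ {r} → r ∈ G → ∀ σ γ δ → All (λ Q → G ⊢ instSeq σ γ δ Q) (Rule.premises r) →
                  G ⊢ instSeq σ γ δ (Rule.conclusion r)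
  rule-instance r∈G σ γ δ = by _ r∈G σ γ δ (↭-refl , refl)

  SlashValid : Seq → Set
  SlashValid (Σ₀ , Λ) = All Slash Σ₀ → Cont (Slash (⋁? Λ))

  -- The premises of a constructive rule as formulas, with Γ erased and schematic atoms read as
  -- variables; a J-premise is negated since Δ will be instantiated by nothing.
  iPremFm : IPrem → Fm
  iPremFm (B , P) = ⋀ (map (inst var) B) ⇒ ⋁? (Maybe.map (inst var) P)

  jPremFm : List MFm → Fm
  jPremFm C = ⋀ (map (inst var) C) ⇒ ⊥ᶠ

  module _ {σ : ℕ → Fm} {γ : List Fm} {δ : Maybe Fm} (v : ℕ → Bool) where
    open UnderValuation σ v

    iPrem-true : ∀ {x} → GoodIPrem x → SlashValid (instSeq σ γ δ (iPrem x)) → All Slash γ →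
                 AgreesOn σ v (iPremAtoms x) → Cont (eval k v (iPremFm x) ≡ true)
    iPrem-true {B , P} (bB , pP) ih γ-slash agree with eval k v (⋀ (map (inst var) B)) in tB
    ... | false = pure refl
    ... | true  = do
      sP ← ih (++⁺ γ-slash
                 (map⁺ (basic-slash-all bB (agreesOn-++ˡ agree) (map⁻ (⋀-true⁻ v _ tB)))))
      almostPositive-trueᴹ pP (agreesOn-++ʳ (atomsᴸ B) agree) sP

    iPrems-true : ∀ {Is} → All GoodIPrem Is → All (λ x → SlashValid (instSeq σ γ δ (iPrem x))) Is →
                  All Slash γ → AgreesOn σ v (concatMap iPremAtoms Is) →
                  Cont (All (λ x → eval k v (iPremFm x) ≡ true) Is)
    iPrems-true []                []          _       _     = pure []
    iPrems-true {x ∷ _} (g ∷ gs) (ih ∷ ihs) γ-slash agree = do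
      t  ← iPrem-true g ih γ-slash (agreesOn-++ˡ agree)
      ts ← iPrems-true gs ihs γ-slash (agreesOn-++ʳ (iPremAtoms x) agree)
      pure (t ∷ ts)

  module LeftRule {Is Js P prs} (good-I : All GoodIPrem Is)
                  (constructive-J : All (All IsConstructiveFm) Js)
                  (basic-J : 1 < length Js → All (All IsBasic) Js) (ap-P : All IsAlmostPositive P)
                  (perm : prs ↭ map iPrem Is ++ map jPrem Js)
                  (r∈G : rule prs (mseq ctxΓ P succΔ) ∈ G) where

    π : Fm
    π = ⋀ (map iPremFm Is) ∧ᶠ ⋀ (map jPremFm Js)

    π-refutes-P : ⋀ (π ∷ map (inst var) P) ⇛ ⊥ᶠ
    π-refutes-P = sound (rule-instance r∈G var (π ∷ []) nothing
      (All-resp-↭ (↭-sym perm)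
        (++⁺ (map⁺ (All.tabulate generic-I)) (map⁺ (All.tabulate generic-J)))))
      where
        generic-I : ∀ {x} → x ∈ Is → G ⊢ instSeq var (π ∷ []) nothing (iPrem x)
        generic-I x∈ = complete-uncurried (⇛-trans (∧-elimˡ ⇛-refl) (⋀-proj (∈-map⁺ iPremFm x∈)))
        generic-J : ∀ {C} → C ∈ Js → G ⊢ instSeq var (π ∷ []) nothing (jPrem C)
        generic-J C∈ = complete-uncurried (⇛-trans (∧-elimʳ ⇛-refl) (⋀-proj (∈-map⁺ jPremFm C∈)))

    some-J-true : ∀ v → All (λ a → eval k v (inst var a) ≡ true) P →
                  All (λ x → eval k v (iPremFm x) ≡ true) Is →
                  Any (λ C → eval k v (⋀ (map (inst var) C)) ≡ true) Js
    some-J-true v tP tI with eval k v (⋀ (map jPremFm Js)) in tJ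
    ... | true with ⇒ᵇ≡true⁻ (valid _ π-refutes-P v)
                          (⋀-true⁺ v (∧≡true⁺ (⋀-true⁺ v (map⁺ tI)) tJ ∷ map⁺ tP))
    ...   | ()
    some-J-true v tP tI | false = Any.map ⇒ᵇfalse≡false⁻ (Any.map⁻ (⋀-false⁻ v _ tJ))

    module _ (σ : ℕ → Fm) (γ : List Fm) (δ : Maybe Fm)
             (prems : All (λ Q → G ⊢ instSeq σ γ δ Q) prs)
             (ihs : All (λ Q → SlashValid (instSeq σ γ δ Q)) prs) where

      I-prems : All (λ x → G ⊢ instSeq σ γ δ (iPrem x)) Is
      I-prems = map⁻ (++⁻ˡ (map iPrem Is) (All-resp-↭ perm prems))

      I-ihs : All (λ x → SlashValid (instSeq σ γ δ (iPrem x))) Is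
      I-ihs = map⁻ (++⁻ˡ (map iPrem Is) (All-resp-↭ perm ihs))

      J-ihs : All (λ C → SlashValid (instSeq σ γ δ (jPrem C))) Js
      J-ihs = map⁻ (++⁻ʳ (map iPrem Is) (All-resp-↭ perm ihs))

      sole-J-prov : ∀ {C} → ¬ 1 < length Js → C ∈ Js → All Slash (γ ++ map (inst σ) P) →
                    Prov (⋀ (map (inst σ) C))
      sole-J-prov {C} one C∈ = derivable-prov (rule-instance r∈G σ γ (just (⋀ Cσ))
          (All-resp-↭ (↭-sym perm) (++⁺ (map⁺ I-prems) (map⁺ (All.tabulate J-trivial)))))
        where
          Cσ : List Fm
          Cσ = map (inst σ) C
          J-trivial : ∀ {C′} → C′ ∈ Js → G ⊢ instSeq σ γ (just (⋀ Cσ)) (jPrem C′)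
          J-trivial C′∈ rewrite ∈-length≤1⇒≡ one C∈ C′∈ =
            complete (⋀-mono {γ ++ Cσ} {Cσ} (∈-++⁺ʳ γ))

      -- Several J-premises are all basic; a sole one may be constructive, and is then provable
      -- from the instance of the rule whose Δ is its own conjunction.
      J-slash : ∀ v {C} → C ∈ Js → All Slash (γ ++ map (inst σ) P) → AgreesOn σ v (atomsᴸ C) →
                All (λ c → eval k v (inst var c) ≡ true) C → Cont (All (λ c → Slash (inst σ c)) C)
      J-slash v C∈ slashes agree tC with 1 <? length Js
      ... | yes many = pure (basic-slash-all (All.lookup (basic-J many) C∈) agree tC)
        where open UnderValuation σ v
      ... | no one = constructive-slash-all (All.lookup constructive-J C∈) agree tC
          (All.tabulate λ c∈ → ⇛-trans (sole-J-prov one C∈ slashes) (⋀-proj (∈-map⁺ (inst σ) c∈)))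
        where open UnderValuation σ v

      slashValid : SlashValid (instSeq σ γ δ (mseq ctxΓ P succΔ))
      slashValid slashes = do
          (v , agree) ← choose-valuation σ atoms-PIJ
          case-J v agree
        where
          atoms-PIJ : List ℕ
          atoms-PIJ = atomsᴸ P ++ concatMap iPremAtoms Is ++ concatMap atomsᴸ Js
          case-J : ∀ v → AgreesOn σ v atoms-PIJ → Cont (Slash (⋁? δ))
          case-J v agree = do
              tP ← almostPositive-true-all ap-P (agreesOn-++ˡ agree) (map⁻ (++⁻ʳ γ slashes))
              tI ← iPrems-true {δ = δ} v good-I I-ihs γ-slash (agreesOn-++ˡ agree-IJ)
              let C , C∈ , tC = find (some-J-true v tP tI)
              sC ← J-slash v C∈ slashes
                     (agreesOn-concatMap atomsᴸ C∈ (agreesOn-++ʳ (concatMap iPremAtoms Is) agree-IJ))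
                     (map⁻ (⋀-true⁻ v _ tC))
              All.lookup J-ihs C∈ (++⁺ γ-slash (map⁺ sC))
            where
              open UnderValuation σ v
              γ-slash : All Slash γ
              γ-slash = ++⁻ˡ γ slashes
              agree-IJ : AgreesOn σ v (concatMap iPremAtoms Is ++ concatMap atomsᴸ Js)
              agree-IJ = agreesOn-++ʳ (atomsᴸ P) agree

  module RightRule {Is P C prs} (good-I : All GoodIPrem Is) (ap-P : All IsAlmostPositive P)
                   (constructive-C : MaybeAll.All IsConstructiveFm C) (perm : prs ↭ map iPrem Is)
                   (r∈G : rule prs (mseq ctxΓ P (succF C)) ∈ G) where

    π : Fm
    π = ⋀ (map iPremFm Is)

    π-proves-C : ⋀ (π ∷ map (inst var) P) ⇛ ⋁? (Maybe.map (inst var) C)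
    π-proves-C = sound (rule-instance r∈G var (π ∷ []) nothing
      (All-resp-↭ (↭-sym perm) (map⁺ (All.tabulate λ x∈ →
        complete-uncurried (⋀-proj (∈-map⁺ iPremFm x∈))))))

    slashValid : ∀ σ γ δ → All (λ Q → G ⊢ instSeq σ γ δ Q) prs →
                 All (λ Q → SlashValid (instSeq σ γ δ Q)) prs →
                 SlashValid (instSeq σ γ δ (mseq ctxΓ P (succF C)))
    slashValid σ γ δ prems ihs slashes = do
        (v , agree) ← choose-valuation σ atoms-PIC
        slash-C v agree
      where
        atoms-PIC : List ℕ
        atoms-PIC = atomsᴸ P ++ concatMap iPremAtoms Is ++ atomsᴹ C
        slash-C : ∀ v → AgreesOn σ v atoms-PIC → Cont (Slash (⋁? (Maybe.map (inst σ) C)))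
        slash-C v agree = do
            tP ← almostPositive-true-all ap-P (agreesOn-++ˡ agree) (map⁻ (++⁻ʳ γ slashes))
            tI ← iPrems-true {δ = δ} v good-I (map⁻ (All-resp-↭ perm ihs)) (++⁻ˡ γ slashes)
                   (agreesOn-++ˡ agree-IC)
            constructive-slashᴹ constructive-C (agreesOn-++ʳ (concatMap iPremAtoms Is) agree-IC)
              (⇒ᵇ≡true⁻ (valid _ π-proves-C v) (⋀-true⁺ v (⋀-true⁺ v (map⁺ tI) ∷ map⁺ tP)))
              (derivable-prov (rule-instance r∈G σ γ δ prems) slashes)
          where
            open UnderValuation σ v
            agree-IC : AgreesOn σ v (concatMap iPremAtoms Is ++ atomsᴹ C)
            agree-IC = agreesOn-++ʳ (atomsᴸ P) agree

  K□-prov : ∀ {γ A} → G ⊢ (γ ++ [] , just A) → All Slash (map □_ γ ++ []) → Prov (□ A)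
  K□-prov {γ} d slashes rewrite ++-identityʳ γ | ++-identityʳ (map □_ γ) =
    ⇛-trans (□-⋀-intro (All.map proj₁ (map⁻ slashes))) (□-mono (sound d))

  K□-slashValid : ∀ {γ A} → FrameAxiom L k → G ⊢ (γ ++ [] , just A) →
                  SlashValid (γ ++ [] , just A) → SlashValid (map □_ γ ++ [] , just (□ A))
  K□-slashValid irreflexive-frame d _ slashes = pure (K□-prov d slashes , tt)
  K□-slashValid {γ} (reflexive-frame _) d ih slashes =
    (K□-prov d slashes ,_) <$> ih (++⁺ (All.map proj₂ (map⁻ (++⁻ˡ (map □_ γ) slashes))) [])

  rule-slashValid : ∀ {r} → r ∈ G → IsConstructiveRule r ⊎ r ≡ K□-rule → ∀ σ γ δ →
                    All (λ Q → G ⊢ instSeq σ γ δ Q) (Rule.premises r) →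
                    All (λ Q → SlashValid (instSeq σ γ δ Q)) (Rule.premises r) →
                    SlashValid (instSeq σ γ δ (Rule.conclusion r))
  rule-slashValid r∈G (inj₁ (left _ _ _ _ good-I constructive-J basic-J ap-P perm)) =
    LeftRule.slashValid good-I constructive-J basic-J ap-P perm r∈G
  rule-slashValid r∈G (inj₁ (right _ _ _ _ good-I ap-P constructive-C perm)) =
    RightRule.slashValid good-I ap-P constructive-C perm r∈G
  rule-slashValid r∈G (inj₂ refl) σ γ δ (d ∷ []) (ih ∷ []) = K□-slashValid frame d ih

  derivable-slashValid : ∀ {s} → G ⊢ s → SlashValid s
  derivable-slashValid-all : ∀ {σ γ δ Qs} → All (λ Q → G ⊢ instSeq σ γ δ Q) Qs →
                             All (λ Q → SlashValid (instSeq σ γ δ Q)) Qs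

  derivable-slashValid (by r r∈G σ γ δ (perm , refl) prems) slashes =
    rule-slashValid r∈G (All.lookup constructive r∈G) σ γ δ prems (derivable-slashValid-all prems)
      (All-resp-↭ (↭-sym perm) slashes)

  derivable-slashValid-all []       = []
  derivable-slashValid-all (d ∷ ds) = derivable-slashValid d ∷ derivable-slashValid-all ds

module Admissibility {L : FmSet} (isL : IsLogic L) (ck : CK ⊆ L) {k : NodeKind}
                     (frame : FrameAxiom L k) (valid : ValidIn k L)
                     {G : Calculus} (constructive : ConstructiveCalculus G)
                     (calculus : CalculusFor G L) where
  open Hilbert isL ck
  private
    module SlashedBy = Soundness isL ck frame valid constructive calculus

  disjunction-property : ∀ A B → L (A ∨ᶠ B) → L A ⊎ L B
  disjunction-property A B ⊢A∨B =
      derivable-slashValid (complete {[]} {just (A ∨ᶠ B)} (⇛-const ⊢A∨B)) [] extract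
    where
      open SlashedBy ⊤ᶠ (L A ⊎ L B)
      extract : Slash (A ∨ᶠ B) → L A ⊎ L B
      extract (inj₁ sA) = inj₁ (modus-ponens (axiom ax10) (slash-prov A sA))
      extract (inj₂ sB) = inj₂ (modus-ponens (axiom ax10) (slash-prov B sB))

  visser-rule : ∀ m → VisserAdmissible L (suc m)
  visser-rule m p q r ⊢premise with disjunction-property _ _ ⊢premise
  ... | inj₂ ⊢r = modus-ponens ⊢r (axiom (ax7 _ r))
  ... | inj₁ ⊢H⇒p = conclude (derivable-slashValid derivation (slash-H ∷ []) extract)
    where
      n : ℕ
      n = suc m
      conjunct : Fin n → Fm
      conjunct i = p (inject₁ (inject₁ i)) ⇒ q i
      H : Fm
      H = ⋀ (map conjunct (allFin n))
      Answer : Set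
      Answer = Σ (Fin (suc (suc n))) λ j → L (H ⇒ p j)
      open SlashedBy H Answer
      disjunction : Fm
      disjunction = p (inject₁ (fromℕ n)) ∨ᶠ p (fromℕ (suc n))
      derivation : G ⊢ (H ∷ [] , just disjunction)
      derivation = complete ⊢H⇒p
      -- No slash of q i is ever needed: the continuation is discarded and p i is the answer.
      conjunct-slash : ∀ i → Slash (conjunct i)
      conjunct-slash i =
        ⋀-proj (∈-map⁺ conjunct (∈-allFin i)) , λ s _ → inject₁ (inject₁ i) , slash-prov _ s
      slash-H : Slash H
      slash-H = slash-⋀ (map⁺ (tabulate⁺ conjunct-slash))
      extract : Slash disjunction → Answer
      extract (inj₁ s) = inject₁ (fromℕ n) , slash-prov _ s
      extract (inj₂ s) = fromℕ (suc n) , slash-prov _ s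
      conclude : Answer → L (visserConclusion m p q r)
      conclude (j , ⊢H⇒pj) = modus-ponens
        (modus-ponens ⊢H⇒pj (⋁-inj (∈-map⁺ (λ j → H ⇒ p j) (∈-allFin j)))) (axiom (ax6 _ r))

  visser-admissible : ∀ n → VisserAdmissible L n
  visser-admissible zero    = disjunction-property
  visser-admissible (suc m) = visser-rule m

corollary5p5 : (L : FmSet) → IsLogic L → (TFree L ⊎ TFull L) →
    Σ ℕ (λ n → ¬ VisserAdmissible L n) →
    ¬ Σ Calculus (λ G → ConstructiveCalculus G × CalculusFor G L)
corollary5p5 L isL (inj₁ (ck , valid)) (n , ¬admissible) (G , constructive , calculus) =
  ¬admissible
    (Admissibility.visser-admissible isL ck irreflexive-frame valid constructive calculus n)
corollary5p5 L isL (inj₂ (ck , ⊢T , valid)) (n , ¬admissible) (G , constructive , calculus) =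
  ¬admissible
    (Admissibility.visser-admissible isL ck (reflexive-frame axT) valid constructive calculus n)
  where
    axT : ∀ A → L (□ A ⇒ A)
    axT A = IsLogic.closed-sub isL (λ _ → A) _ ⊢T
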